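{- Let $G$ be a monochromatic complete bipartite graph $K_{m,n}$ with $m\ge n\ge 2$ and $m+n\ge 9$. Then $pc_{opt}(G)=4$ if $n\in\{2,3\}$, and $pc_{opt}(G)=5$ if $n\ge 4$.
   Context: An edge-colored graph is properly colored if no two adjacent edges share a color; an edge-colored connected graph is properly connected if between every pair of distinct vertices there is a properly colored path. A monochromatic graph is one in which every edge has color $0$; any color $i\neq 0$ is a new color. For a monochromatic connected graph $G$, $pc_{opt}(G)$ is the minimum of $p+q$ over all ways to make $G$ properly connected by recoloring $p$ edges of $G$ using $q$ new colors. -}

module Defs where

open import Data.Nat using (ℕ; zero; suc; _+_; _≤_; _≟_)
open import Data.Fin using (Fin)
open import Data.Sum using (_⊎_; inj₁; inj₂)
open import Data.Product using (_×_; ∃; Σ)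
open import Data.Unit using (⊤)
open import Data.Empty using (⊥)
open import Data.List using (List; []; _∷_; _++_; length; filter; concatMap; map; allFin; deduplicate)
open import Data.List.Relation.Unary.Unique.Propositional using (Unique)
open import Relation.Binary.PropositionalEquality using (_≡_; _≢_)
open import Relation.Nullary using (¬?)

Vertex : ℕ → ℕ → Set
Vertex m n = Fin m ⊎ Fin n

Adj : ∀ {m n} → Vertex m n → Vertex m n → Set
Adj (inj₁ _) (inj₂ _) = ⊤
Adj (inj₂ _) (inj₁ _) = ⊤
Adj _ _ = ⊥

-- An edge-coloring of K_{m,n} with colors in ℕ: edge {inj₁ i, inj₂ j} gets c i j.
-- Color 0 is the original color; any color ≠ 0 is a new color.
Coloring : ℕ → ℕ → Set
Coloring m n = Fin m → Fin n → ℕ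

-- Color of the edge between two vertices (value for non-adjacent pairs is irrelevant).
colorOf : ∀ {m n} → Coloring m n → Vertex m n → Vertex m n → ℕ
colorOf c (inj₁ i) (inj₂ j) = c i j
colorOf c (inj₂ j) (inj₁ i) = c i j
colorOf c _ _ = 0

AdjChain : ∀ {m n} → List (Vertex m n) → Set
AdjChain (x ∷ y ∷ rest) = Adj x y × AdjChain (y ∷ rest)
AdjChain _ = ⊤

ProperChain : ∀ {m n} → Coloring m n → List (Vertex m n) → Set
ProperChain c (x ∷ y ∷ z ∷ rest) = (colorOf c x y ≢ colorOf c y z) × ProperChain c (y ∷ z ∷ rest)
ProperChain c _ = ⊤

ProperPath : ∀ {m n} → Coloring m n → Vertex m n → Vertex m n → Set
ProperPath {m} {n} c u v =
  ∃ λ (mid : List (Vertex m n)) →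
    Unique (u ∷ mid ++ v ∷ []) × AdjChain (u ∷ mid ++ v ∷ []) × ProperChain c (u ∷ mid ++ v ∷ [])

ProperlyConnected : ∀ {m n} → Coloring m n → Set
ProperlyConnected c = ∀ u v → u ≢ v → ProperPath c u v

edgeColors : ∀ {m n} → Coloring m n → List ℕ
edgeColors {m} {n} c = concatMap (λ i → map (λ j → c i j) (allFin n)) (allFin m)

newColorsList : ∀ {m n} → Coloring m n → List ℕ
newColorsList c = filter (λ k → ¬? (k ≟ 0)) (edgeColors c)

recolored : ∀ {m n} → Coloring m n → ℕ
recolored c = length (newColorsList c)

newColorCount : ∀ {m n} → Coloring m n → ℕ
newColorCount c = length (deduplicate _≟_ (newColorsList c))

cost : ∀ {m n} → Coloring m n → ℕ
cost c = recolored c + newColorCount c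

PcOptIs : ℕ → ℕ → ℕ → Set
PcOptIs m n k =
  (∃ λ (c : Coloring m n) → ProperlyConnected c × cost c ≡ k)
  × (∀ (c : Coloring m n) → ProperlyConnected c → k ≤ cost c)

module Submission where

-- Notation: p = number of recoloured edges, q = number of new colours; a
-- vertex is clean if all its edges keep colour 0, and a fork at a vertex is
-- a pair of its edges carrying two distinct new colours.
--
-- The key fact (fork-on-path) is that a properly coloured
-- path between two clean vertices of the same part has a fork at a vertex
-- of that part: along the path 0-edges and new edges must alternate at the
-- vertices of that part until two new edges meet, and the path ends with a
-- 0-edge.  At most p rows (columns) are not clean, so m ≥ p + 2 gives a row
-- fork, hence p ≥ 2 and q ≥ 2, and n ≥ p + 2 gives a column fork.  Thus
-- p + q ≥ 4 for m ≥ 4 (cost≥4).  For m ≥ 5, n ≥ 4, p + q ≤ 4 forces p ≤ 2,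
-- hence a row fork and a column fork, which need three recoloured edges
-- (cost≥5).
--
-- Colouring two edges at one vertex with 1 and 2 costs 2 + 2
-- and is properly connected when n ≤ 3; colouring also, with 2, a second
-- edge at the other end of the edge coloured 1 costs 3 + 2 and is properly
-- connected for all m, n ≥ 2.

open import Defs
open import Data.Nat using (ℕ; zero; suc; _+_; _≤_; z≤n; s≤s; _≟_; _≤?_)
open import Data.Nat.Properties
  using (+-0-commutativeMonoid; ≤-trans; ≤-refl; +-mono-≤; +-monoʳ-≤; m≤m+n; m≤n+m; n≤0⇒n≡0; ≰⇒>; +-cancelʳ-≤; ≤-pred; <-irrefl; module ≤-Reasoning)
open import Data.Fin using (Fin; zero; suc; punchOut; punchIn)
import Data.Fin as Fin
open import Data.Fin.Properties using (punchIn-punchOut; suc-injective)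
open import Data.Sum using (inj₁; inj₂)
open import Data.Sum.Properties using (inj₁-injective; inj₂-injective)
open import Data.Product using (_×_; _,_; ∃; ∃₂; proj₁)
open import Data.Unit using (⊤; tt)
open import Data.Empty using (⊥; ⊥-elim)
open import Data.List using (List; []; _∷_; _++_; length; filter; concat; map; tabulate; allFin; deduplicate)
open import Data.List.Properties using (filter-++; filter-none; length-++; map-tabulate; tabulate-cong)
open import Data.List.Membership.Propositional using (_∈_; lose)
open import Data.List.Membership.Propositional.Properties
  using (∈-deduplicate⁺; ∈-filter⁺; ∈-concatMap⁺; ∈-map⁺; ∈-allFin)
open import Data.List.Relation.Unary.Any using (here; there)
open import Data.List.Relation.Unary.All using ([]; _∷_)
open import Data.List.Relation.Unary.All.Properties using (tabulate⁺)
open import Data.List.Relation.Unary.AllPairs using ([]; _∷_)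
open import Algebra.Properties.CommutativeMonoid.Sum +-0-commutativeMonoid
  using (sum; sum-cong-≗; sum-remove; ∑-comm)
open import Relation.Binary.PropositionalEquality
open import Function using (id; _∘′_)
open import Relation.Nullary using (¬_; ¬?; Dec; yes; no; contradiction)

private
  variable
    m n : ℕ

isNew? : (k : ℕ) → Dec (k ≢ 0)
isNew? k = ¬? (k ≟ 0)

isNew : ℕ → ℕ
isNew zero = 0
isNew (suc _) = 1

isNew-≢0 : ∀ {k} → k ≢ 0 → 1 ≤ isNew k
isNew-≢0 {zero} k≢0 = contradiction refl k≢0
isNew-≢0 {suc _} _ = ≤-refl

isNew-≡0 : ∀ {k} → isNew k ≡ 0 → k ≡ 0
isNew-≡0 {zero} _ = refl

rowNew : Coloring m n → Fin m → ℕ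
rowNew c i = sum (λ j → isNew (c i j))

colNew : Coloring m n → Fin n → ℕ
colNew c j = sum (λ i → isNew (c i j))

newInRow : Coloring m n → Fin m → List ℕ
newInRow c i = filter isNew? (tabulate (c i))

length-newIn : ∀ {k} (f : Fin k → ℕ) → length (filter isNew? (tabulate f)) ≡ sum (λ j → isNew (f j))
length-newIn {zero} f = refl
length-newIn {suc k} f with f zero
... | zero = length-newIn (λ j → f (suc j))
... | suc _ = cong suc (length-newIn (λ j → f (suc j)))

filter-concat : ∀ {k} (rows : Fin k → List ℕ) →
  filter isNew? (concat (tabulate rows)) ≡ concat (tabulate (λ i → filter isNew? (rows i)))
filter-concat {zero} rows = refl
filter-concat {suc k} rows =
  trans (filter-++ isNew? (rows zero) _) (cong (filter isNew? (rows zero) ++_) (filter-concat (λ i → rows (suc i))))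

length-concat : ∀ {k} (rows : Fin k → List ℕ) → length (concat (tabulate rows)) ≡ sum (λ i → length (rows i))
length-concat {zero} rows = refl
length-concat {suc k} rows =
  trans (length-++ (rows zero)) (cong (length (rows zero) +_) (length-concat (λ i → rows (suc i))))

newColors-byRow : (c : Coloring m n) → newColorsList c ≡ concat (tabulate (newInRow c))
newColors-byRow {m} {n} c = begin
  filter isNew? (concat (map (λ i → map (c i) (allFin n)) (allFin m)))
    ≡⟨ cong (filter isNew? ∘′ concat) (map-tabulate id (λ i → map (c i) (allFin n))) ⟩
  filter isNew? (concat (tabulate (λ i → map (c i) (allFin n))))
    ≡⟨ cong (filter isNew? ∘′ concat) (tabulate-cong (λ i → map-tabulate id (c i))) ⟩
  filter isNew? (concat (tabulate (λ i → tabulate (c i))))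
    ≡⟨ filter-concat (λ i → tabulate (c i)) ⟩
  concat (tabulate (newInRow c)) ∎
  where
  open ≡-Reasoning

recolored-rows : (c : Coloring m n) → recolored c ≡ sum (rowNew c)
recolored-rows c = begin
  length (newColorsList c)                  ≡⟨ cong length (newColors-byRow c) ⟩
  length (concat (tabulate (newInRow c)))   ≡⟨ length-concat (newInRow c) ⟩
  sum (λ i → length (newInRow c i))         ≡⟨ sum-cong-≗ (λ i → length-newIn (c i)) ⟩
  sum (rowNew c)                            ∎
  where open ≡-Reasoning

recolored-cols : (c : Coloring m n) → recolored c ≡ sum (colNew c)
recolored-cols c = trans (recolored-rows c) (∑-comm (λ i j → isNew (c i j)))

entry≤sum : ∀ {k} (f : Fin k → ℕ) i → f i ≤ sum f
entry≤sum f zero = m≤m+n _ _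
entry≤sum f (suc i) = ≤-trans (entry≤sum (λ j → f (suc j)) i) (m≤n+m _ (f zero))

pair≤sum : ∀ {k} (f : Fin k → ℕ) i j → i ≢ j → f i + f j ≤ sum f
pair≤sum {suc k} f i j i≢j = begin
  f i + f j                                    ≡⟨ cong (λ x → f i + f x) (sym (punchIn-punchOut i≢j)) ⟩
  f i + f (punchIn i (punchOut i≢j))           ≤⟨ +-monoʳ-≤ (f i) (entry≤sum (λ x → f (punchIn i x)) (punchOut i≢j)) ⟩
  f i + sum (λ x → f (punchIn i x))            ≡⟨ sym (sum-remove f) ⟩
  sum f                                        ∎
  where open ≤-Reasoning

zero-entry : ∀ {k} (f : Fin k → ℕ) → suc (sum f) ≤ k → ∃ λ i → f i ≡ 0
zero-entry {suc k} f (s≤s h) with f zero in eq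
... | zero = zero , eq
... | suc x with zero-entry (λ j → f (suc j)) (≤-trans (s≤s (m≤n+m _ x)) h)
...   | i , e = suc i , e

two-zero-entries : ∀ {k} (f : Fin k → ℕ) → 2 + sum f ≤ k → ∃₂ λ i i' → i ≢ i' × f i ≡ 0 × f i' ≡ 0
two-zero-entries {suc k} f (s≤s h) with f zero in eq
... | zero with zero-entry (λ j → f (suc j)) h
...   | i , e = zero , suc i , (λ ()) , eq , e
two-zero-entries {suc k} f (s≤s h) | suc x
  with two-zero-entries (λ j → f (suc j)) (≤-trans (s≤s (s≤s (m≤n+m _ x))) h)
... | i , i' , i≢i' , e , e' = suc i , suc i' , (λ s → i≢i' (suc-injective s)) , e , e'

sum≡0⇒entry≡0 : ∀ {k} (f : Fin k → ℕ) → sum f ≡ 0 → ∀ i → f i ≡ 0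
sum≡0⇒entry≡0 f e i = n≤0⇒n≡0 (subst (f i ≤_) e (entry≤sum f i))

row≤recolored : (c : Coloring m n) → ∀ i → rowNew c i ≤ recolored c
row≤recolored c i = subst (rowNew c i ≤_) (sym (recolored-rows c)) (entry≤sum (rowNew c) i)

newColorCount-pos : (c : Coloring m n) → 1 ≤ recolored c → 1 ≤ newColorCount c
newColorCount-pos c p≥1 with newColorsList c
... | []    = contradiction p≥1 λ ()
... | _ ∷ _ = s≤s z≤n

newColor∈ : (c : Coloring m n) → ∀ i j → c i j ≢ 0 → c i j ∈ newColorsList c
newColor∈ c i j c≢0 = ∈-filter⁺ isNew? (∈-concatMap⁺ _ (lose (∈-allFin i) (∈-map⁺ (c i) (∈-allFin j)))) c≢0

two-elements : ∀ {a b : ℕ} xs → a ∈ xs → b ∈ xs → a ≢ b → 2 ≤ length xs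
two-elements (_ ∷ []) (here refl) (here refl) a≢b = contradiction refl a≢b
two-elements (_ ∷ []) (there ()) _ _
two-elements (_ ∷ []) (here _) (there ()) _
two-elements (_ ∷ _ ∷ _) _ _ _ = s≤s (s≤s z≤n)

two-newColors : (c : Coloring m n) → ∀ i j i' j' → c i j ≢ 0 → c i' j' ≢ 0 → c i j ≢ c i' j' → 2 ≤ newColorCount c
two-newColors c i j i' j' n₁ n₂ d =
  two-elements _ (∈-deduplicate⁺ _≟_ (newColor∈ c i j n₁)) (∈-deduplicate⁺ _≟_ (newColor∈ c i' j' n₂)) d

private
  ≢₁ : ∀ {i i' : Fin m} → i ≢ i' → inj₁ {B = Fin n} i ≢ inj₁ i'
  ≢₁ i≢i' e = i≢i' (inj₁-injective e)

  ≢₂ : ∀ {j j' : Fin n} → j ≢ j' → inj₂ {A = Fin m} j ≢ inj₂ j'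
  ≢₂ j≢j' e = j≢j' (inj₂-injective e)

SameSide : Vertex m n → Vertex m n → Set
SameSide (inj₁ _) (inj₁ _) = ⊤
SameSide (inj₂ _) (inj₂ _) = ⊤
SameSide _ _ = ⊥

adjacent-opposite : ∀ {x y : Vertex m n} → Adj x y → ¬ SameSide x y
adjacent-opposite {x = inj₁ _} {inj₂ _} _ ()
adjacent-opposite {x = inj₂ _} {inj₁ _} _ ()

two-steps : ∀ {x y z v : Vertex m n} → Adj x y → Adj y z → SameSide x v → SameSide z v
two-steps {x = inj₁ _} {inj₂ _} {inj₁ _} {inj₁ _} _ _ _ = tt
two-steps {x = inj₂ _} {inj₁ _} {inj₂ _} {inj₂ _} _ _ _ = tt

colorOf-sym : (c : Coloring m n) → ∀ x y → colorOf c x y ≡ colorOf c y x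
colorOf-sym c (inj₁ _) (inj₁ _) = refl
colorOf-sym c (inj₁ _) (inj₂ _) = refl
colorOf-sym c (inj₂ _) (inj₁ _) = refl
colorOf-sym c (inj₂ _) (inj₂ _) = refl

Clean : Coloring m n → Vertex m n → Set
Clean c u = ∀ w → colorOf c u w ≡ 0

Fork : Coloring m n → Vertex m n → Set
Fork {m} {n} c y = ∃₂ λ (x z : Vertex m n) →
  colorOf c x y ≢ 0 × colorOf c y z ≢ 0 × colorOf c x y ≢ colorOf c y z

data Last {A : Set} (v : A) : List A → Set where
  end  : Last v (v ∷ [])
  step : ∀ {x xs} → Last v xs → Last v (x ∷ xs)

last-++ : ∀ {A : Set} {v : A} xs → Last v (xs ++ v ∷ [])
last-++ [] = end
last-++ (_ ∷ xs) = step (last-++ xs)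

-- Following a properly coloured walk towards a clean vertex v: as long as
-- the walk stands in v's part having just used a 0-edge, the next edge is
-- new, and the one after it is either 0 again (repeat) or a second, distinct
-- new colour (a fork).  The walk cannot end in this pattern since v is clean.
module _ (c : Coloring m n) (v : Vertex m n) (v-clean : Clean c v) where

  ForkOnSideOf : Set
  ForkOnSideOf = ∃ λ y → SameSide y v × Fork c y

  private
    after-zero : ∀ x y rest → SameSide x v → colorOf c x y ≡ 0 →
      AdjChain (x ∷ y ∷ rest) → ProperChain c (x ∷ y ∷ rest) → Last v (y ∷ rest) → ForkOnSideOf
    after-new : ∀ x y rest → SameSide y v → colorOf c x y ≢ 0 →
      AdjChain (x ∷ y ∷ rest) → ProperChain c (x ∷ y ∷ rest) → Last v (y ∷ rest) → ForkOnSideOf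

    after-zero x y [] x~v _ (x-y , _) _ end = ⊥-elim (adjacent-opposite x-y x~v)
    after-zero x y [] _ _ _ _ (step ())
    after-zero x y (z ∷ rest) x~v xy≡0 (x-y , chain) (xy≢yz , proper) (step rest-end) =
      after-new y z rest (two-steps x-y (proj₁ chain) x~v) (λ yz≡0 → xy≢yz (trans xy≡0 (sym yz≡0))) chain proper rest-end

    after-new x y [] _ xy≢0 _ _ end = contradiction (trans (colorOf-sym c x v) (v-clean x)) xy≢0
    after-new x y [] _ _ _ _ (step ())
    after-new x y (z ∷ rest) y~v xy≢0 (_ , chain) (xy≢yz , proper) (step rest-end) with colorOf c y z ≟ 0
    ... | yes yz≡0 = after-zero y z rest y~v yz≡0 chain proper rest-end
    ... | no yz≢0 = y , y~v , x , z , xy≢0 , yz≢0 , xy≢yz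

  fork-on-path : ∀ u → SameSide u v → Clean c u → ProperPath c u v → ForkOnSideOf
  fork-on-path u u~v _ ([] , _ , (u-v , _) , _) = ⊥-elim (adjacent-opposite u-v u~v)
  fork-on-path u u~v u-clean (y ∷ mid , _ , chain , proper) =
    after-zero u y (mid ++ v ∷ []) u~v (u-clean y) chain proper (last-++ (y ∷ mid))

RowFork : Coloring m n → Fin m → Set
RowFork {m} {n} c i = ∃₂ λ (j j' : Fin n) → c i j ≢ 0 × c i j' ≢ 0 × c i j ≢ c i j'

ColFork : Coloring m n → Fin n → Set
ColFork {m} {n} c j = ∃₂ λ (i i' : Fin m) → c i j ≢ 0 × c i' j ≢ 0 × c i j ≢ c i' j

-- Edges carrying a new colour join the two parts, so a fork at a vertex of
-- the first (second) part is a row (column) fork.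
row-fork : (c : Coloring m n) → ∀ {i} → Fork c (inj₁ i) → RowFork c i
row-fork c (inj₂ j , inj₂ j' , n₁ , n₂ , d) = j , j' , n₁ , n₂ , d
row-fork c (inj₁ _ , _ , n₁ , _ , _) = contradiction refl n₁
row-fork c (inj₂ _ , inj₁ _ , _ , n₂ , _) = contradiction refl n₂

col-fork : (c : Coloring m n) → ∀ {j} → Fork c (inj₂ j) → ColFork c j
col-fork c (inj₁ i , inj₁ i' , n₁ , n₂ , d) = i , i' , n₁ , n₂ , d
col-fork c (inj₂ _ , _ , n₁ , _ , _) = contradiction refl n₁
col-fork c (inj₁ _ , inj₂ _ , _ , n₂ , _) = contradiction refl n₂

clean-row : (c : Coloring m n) → ∀ i → rowNew c i ≡ 0 → Clean c (inj₁ i)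
clean-row c i e (inj₁ _) = refl
clean-row c i e (inj₂ j) = isNew-≡0 (sum≡0⇒entry≡0 (λ x → isNew (c i x)) e j)

clean-col : (c : Coloring m n) → ∀ j → colNew c j ≡ 0 → Clean c (inj₂ j)
clean-col c j e (inj₁ i) = isNew-≡0 (sum≡0⇒entry≡0 (λ x → isNew (c x j)) e i)
clean-col c j e (inj₂ _) = refl

rowFork-exists : (c : Coloring m n) → ProperlyConnected c → 2 + recolored c ≤ m → ∃ (RowFork c)
rowFork-exists c connected h
  with two-zero-entries (rowNew c) (subst (λ p → 2 + p ≤ _) (recolored-rows c) h)
... | a , a' , a≢a' , e , e'
  with fork-on-path c (inj₁ a') (clean-row c a' e') (inj₁ a) tt (clean-row c a e)
         (connected (inj₁ a) (inj₁ a') (≢₁ a≢a'))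
... | inj₁ i , _ , fork = i , row-fork c fork

colFork-exists : (c : Coloring m n) → ProperlyConnected c → 2 + recolored c ≤ n → ∃ (ColFork c)
colFork-exists c connected h
  with two-zero-entries (colNew c) (subst (λ p → 2 + p ≤ _) (recolored-cols c) h)
... | b , b' , b≢b' , e , e'
  with fork-on-path c (inj₂ b') (clean-col c b' e') (inj₂ b) tt (clean-col c b e)
         (connected (inj₂ b) (inj₂ b') (≢₂ b≢b'))
... | inj₂ j , _ , fork = j , col-fork c fork

rowFork-recolored : (c : Coloring m n) → ∀ {i} → RowFork c i → 2 ≤ rowNew c i
rowFork-recolored c {i} (j , j' , n₁ , n₂ , d) =
  ≤-trans (+-mono-≤ (isNew-≢0 n₁) (isNew-≢0 n₂)) (pair≤sum (λ x → isNew (c i x)) j j' (λ j≡j' → d (cong (c i) j≡j')))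

rowFork-newColors : (c : Coloring m n) → ∀ {i} → RowFork c i → 2 ≤ newColorCount c
rowFork-newColors c {i} (j , j' , n₁ , n₂ , d) = two-newColors c i j i j' n₁ n₂ d

rowFork-and-cell : (c : Coloring m n) → ∀ {i a k} → RowFork c i → a ≢ i → c a k ≢ 0 → 3 ≤ recolored c
rowFork-and-cell c {i} {a} {k} fork a≢i cak≢0 = begin
  2 + 1                    ≤⟨ +-mono-≤ (rowFork-recolored c fork) (≤-trans (isNew-≢0 cak≢0) (entry≤sum (λ x → isNew (c a x)) k)) ⟩
  rowNew c i + rowNew c a  ≤⟨ pair≤sum (rowNew c) i a (λ i≡a → a≢i (sym i≡a)) ⟩
  sum (rowNew c)           ≡⟨ sym (recolored-rows c) ⟩
  recolored c              ∎
  where open ≤-Reasoning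

-- A row fork and a column fork together need three recoloured edges: the
-- two rows of the column fork cannot both be the row of the row fork.
forks-need-three : (c : Coloring m n) → ∀ {i l} → RowFork c i → ColFork c l → 3 ≤ recolored c
forks-need-three c {i} {l} fork (a , a' , n₁ , n₂ , d) with a Fin.≟ i
... | no a≢i = rowFork-and-cell c fork a≢i n₁
... | yes refl = rowFork-and-cell c fork (λ a'≡a → d (cong (λ x → c x l) (sym a'≡a))) n₂

cost≥4 : (c : Coloring m n) → 4 ≤ m → ProperlyConnected c → 4 ≤ cost c
cost≥4 c m≥4 connected with 3 ≤? recolored c
... | yes p≥3 = +-mono-≤ p≥3 (newColorCount-pos c (≤-trans (s≤s z≤n) p≥3))
... | no p≱3 with rowFork-exists c connected (≤-trans (s≤s (≰⇒> p≱3)) m≥4)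
...   | _ , fork = +-mono-≤ (≤-trans (rowFork-recolored c fork) (row≤recolored c _)) (rowFork-newColors c fork)

cost≥5 : (c : Coloring m n) → 5 ≤ m → 4 ≤ n → ProperlyConnected c → 5 ≤ cost c
cost≥5 c m≥5 n≥4 connected with 4 ≤? recolored c
... | yes p≥4 = +-mono-≤ p≥4 (newColorCount-pos c (≤-trans (s≤s z≤n) p≥4))
... | no p≱4 with rowFork-exists c connected (≤-trans (s≤s (≰⇒> p≱4)) m≥5)
...   | _ , fork with 3 ≤? recolored c
...     | yes p≥3 = +-mono-≤ p≥3 (rowFork-newColors c fork)
...     | no p≱3 with colFork-exists c connected (≤-trans (s≤s (≰⇒> p≱3)) n≥4)
...       | _ , colFork = contradiction (forks-need-three c fork colFork) p≱3

module _ (c : Coloring m n) where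

  edge-path : ∀ {u v} → Adj u v → u ≢ v → ProperPath c u v
  edge-path u-v u≢v = [] , (u≢v ∷ []) ∷ [] ∷ [] , (u-v , tt) , tt

  via-column : ∀ {i i'} j → i ≢ i' → c i j ≢ c i' j → ProperPath c (inj₁ i) (inj₁ i')
  via-column j i≢i' d = inj₂ j ∷ [] ,
    ((λ ()) ∷ ≢₁ i≢i' ∷ []) ∷ ((λ ()) ∷ []) ∷ [] ∷ [] , (tt , tt , tt) , (d , tt)

  via-row : ∀ {j j'} i → j ≢ j' → c i j ≢ c i j' → ProperPath c (inj₂ j) (inj₂ j')
  via-row i j≢j' d = inj₁ i ∷ [] ,
    ((λ ()) ∷ ≢₂ j≢j' ∷ []) ∷ ((λ ()) ∷ []) ∷ [] ∷ [] , (tt , tt , tt) , (d , tt)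

  row-zigzag : ∀ {i a i' j j'} → i ≢ a → i ≢ i' → a ≢ i' → j ≢ j' →
    c i j ≢ c a j → c a j ≢ c a j' → c a j' ≢ c i' j' → ProperPath c (inj₁ i) (inj₁ i')
  row-zigzag {i} {a} {i'} {j} {j'} i≢a i≢i' a≢i' j≢j' d₁ d₂ d₃ = inj₂ j ∷ inj₁ a ∷ inj₂ j' ∷ [] ,
    ((λ ()) ∷ ≢₁ i≢a ∷ (λ ()) ∷ ≢₁ i≢i' ∷ []) ∷ ((λ ()) ∷ ≢₂ j≢j' ∷ (λ ()) ∷ []) ∷
      ((λ ()) ∷ ≢₁ a≢i' ∷ []) ∷ ((λ ()) ∷ []) ∷ [] ∷ [] ,
    (tt , tt , tt , tt , tt) , (d₁ , d₂ , d₃ , tt)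

  col-zigzag : ∀ {j b j' i i'} → j ≢ b → j ≢ j' → b ≢ j' → i ≢ i' →
    c i j ≢ c i b → c i b ≢ c i' b → c i' b ≢ c i' j' → ProperPath c (inj₂ j) (inj₂ j')
  col-zigzag {j} {b} {j'} {i} {i'} j≢b j≢j' b≢j' i≢i' d₁ d₂ d₃ = inj₁ i ∷ inj₂ b ∷ inj₁ i' ∷ [] ,
    ((λ ()) ∷ ≢₂ j≢b ∷ (λ ()) ∷ ≢₂ j≢j' ∷ []) ∷ ((λ ()) ∷ ≢₁ i≢i' ∷ (λ ()) ∷ []) ∷
      ((λ ()) ∷ ≢₂ b≢j' ∷ []) ∷ ((λ ()) ∷ []) ∷ [] ∷ [] ,
    (tt , tt , tt , tt , tt) , (d₁ , d₂ , d₃ , tt)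

  connected-byParts : (∀ {i i'} → i ≢ i' → ProperPath c (inj₁ i) (inj₁ i')) →
                      (∀ {j j'} → j ≢ j' → ProperPath c (inj₂ j) (inj₂ j')) → ProperlyConnected c
  connected-byParts rows cols (inj₁ i) (inj₁ i') d = rows (λ e → d (cong inj₁ e))
  connected-byParts rows cols (inj₁ i) (inj₂ j) d = edge-path tt d
  connected-byParts rows cols (inj₂ j) (inj₁ i) d = edge-path tt d
  connected-byParts rows cols (inj₂ j) (inj₂ j') d = cols (λ e → d (cong inj₂ e))

forkColoring : Coloring m n
forkColoring zero zero = 1
forkColoring zero (suc zero) = 2
forkColoring _ _ = 0

doubleForkColoring : Coloring m n
doubleForkColoring zero zero = 1
doubleForkColoring zero (suc zero) = 2
doubleForkColoring (suc zero) zero = 2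
doubleForkColoring _ _ = 0

no-newColors : ∀ {k} (f : Fin k → ℕ) → (∀ j → f j ≡ 0) → filter isNew? (tabulate f) ≡ []
no-newColors f f≡0 = filter-none isNew? (tabulate⁺ (λ j fj≢0 → fj≢0 (f≡0 j)))

no-newColors-rows : ∀ {k} (rows : Fin k → List ℕ) → (∀ i → rows i ≡ []) → concat (tabulate rows) ≡ []
no-newColors-rows {zero} rows _ = refl
no-newColors-rows {suc k} rows empty = cong₂ _++_ (empty zero) (no-newColors-rows (λ i → rows (suc i)) (λ i → empty (suc i)))

cost-by-list : (c : Coloring m n) → ∀ {xs} → newColorsList c ≡ xs → cost c ≡ length xs + length (deduplicate _≟_ xs)
cost-by-list c eq = cong (λ xs → length xs + length (deduplicate _≟_ xs)) eq

forkColoring-cost : cost (forkColoring {suc m} {suc (suc n)}) ≡ 4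
forkColoring-cost {m} {n} = cost-by-list c (trans (newColors-byRow c)
  (cong₂ _++_ (cong (λ xs → 1 ∷ 2 ∷ xs) (no-newColors (λ j → c zero (suc (suc j))) λ _ → refl))
              (no-newColors-rows (λ i → newInRow c (suc i)) λ i → no-newColors (c (suc i)) λ _ → refl)))
  where
  c : Coloring (suc m) (suc (suc n))
  c = forkColoring

doubleForkColoring-cost : cost (doubleForkColoring {suc (suc m)} {suc (suc n)}) ≡ 5
doubleForkColoring-cost {m} {n} = cost-by-list c (trans (newColors-byRow c)
  (cong₂ _++_ (cong (λ xs → 1 ∷ 2 ∷ xs) (no-newColors (λ j → c zero (suc (suc j))) λ _ → refl))
    (cong₂ _++_ (cong (2 ∷_) (no-newColors (λ j → c (suc zero) (suc j)) λ _ → refl))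
                (no-newColors-rows (λ i → newInRow c (suc (suc i))) λ i → no-newColors (c (suc (suc i))) λ _ → refl))))
  where
  c : Coloring (suc (suc m)) (suc (suc n))
  c = doubleForkColoring

fin-unique : ∀ {k} → k ≤ 1 → (x y : Fin k) → x ≡ y
fin-unique {suc zero} _ zero zero = refl
fin-unique {suc (suc _)} (s≤s ()) _ _

-- With at most one column beyond the first two, forkColoring is properly
-- connected: row 0 meets the other rows through column 0, two other rows
-- are joined along row 0, and any two columns meet through row 0.
forkColoring-connected : n ≤ 1 → ProperlyConnected (forkColoring {suc m} {suc (suc n)})
forkColoring-connected {n = n} {m = m} n≤1 = connected-byParts c rows cols
  where
  c : Coloring (suc m) (suc (suc n))
  c = forkColoring
  rows : ∀ {i i'} → i ≢ i' → ProperPath c (inj₁ i) (inj₁ i')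
  rows {zero} {zero} d = contradiction refl d
  rows {zero} {suc _} _ = via-column c zero (λ ()) (λ ())
  rows {suc _} {zero} _ = via-column c zero (λ ()) (λ ())
  rows {suc _} {suc _} d = row-zigzag c {a = zero} {j = zero} {j' = suc zero} (λ ()) d (λ ()) (λ ()) (λ ()) (λ ()) (λ ())
  cols : ∀ {j j'} → j ≢ j' → ProperPath c (inj₂ j) (inj₂ j')
  cols {zero} {zero} d = contradiction refl d
  cols {zero} {suc zero} _ = via-row c zero (λ ()) (λ ())
  cols {zero} {suc (suc _)} _ = via-row c zero (λ ()) (λ ())
  cols {suc zero} {zero} _ = via-row c zero (λ ()) (λ ())
  cols {suc zero} {suc zero} d = contradiction refl d
  cols {suc zero} {suc (suc _)} _ = via-row c zero (λ ()) (λ ())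
  cols {suc (suc _)} {zero} _ = via-row c zero (λ ()) (λ ())
  cols {suc (suc _)} {suc zero} _ = via-row c zero (λ ()) (λ ())
  cols {suc (suc j)} {suc (suc j')} d = contradiction (cong (λ x → suc (suc x)) (fin-unique n≤1 j j')) d

-- doubleForkColoring is properly connected for all m, n ≥ 2: two rows meet
-- through column 0, and two columns through row 0, unless both lie beyond
-- the first two; those are joined by a zigzag through the recoloured edges.
doubleForkColoring-connected : ProperlyConnected (doubleForkColoring {suc (suc m)} {suc (suc n)})
doubleForkColoring-connected {m} {n} = connected-byParts c rows cols
  where
  c : Coloring (suc (suc m)) (suc (suc n))
  c = doubleForkColoring
  rows : ∀ {i i'} → i ≢ i' → ProperPath c (inj₁ i) (inj₁ i')
  rows {zero} {zero} d = contradiction refl d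
  rows {zero} {suc zero} _ = via-column c zero (λ ()) (λ ())
  rows {zero} {suc (suc _)} _ = via-column c zero (λ ()) (λ ())
  rows {suc zero} {zero} _ = via-column c zero (λ ()) (λ ())
  rows {suc zero} {suc zero} d = contradiction refl d
  rows {suc zero} {suc (suc _)} _ = via-column c zero (λ ()) (λ ())
  rows {suc (suc _)} {zero} _ = via-column c zero (λ ()) (λ ())
  rows {suc (suc _)} {suc zero} _ = via-column c zero (λ ()) (λ ())
  rows {suc (suc _)} {suc (suc _)} d =
    row-zigzag c {a = zero} {j = zero} {j' = suc zero} (λ ()) d (λ ()) (λ ()) (λ ()) (λ ()) (λ ())
  cols : ∀ {j j'} → j ≢ j' → ProperPath c (inj₂ j) (inj₂ j')
  cols {zero} {zero} d = contradiction refl d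
  cols {zero} {suc zero} _ = via-row c zero (λ ()) (λ ())
  cols {zero} {suc (suc _)} _ = via-row c zero (λ ()) (λ ())
  cols {suc zero} {zero} _ = via-row c zero (λ ()) (λ ())
  cols {suc zero} {suc zero} d = contradiction refl d
  cols {suc zero} {suc (suc _)} _ = via-row c zero (λ ()) (λ ())
  cols {suc (suc _)} {zero} _ = via-row c zero (λ ()) (λ ())
  cols {suc (suc _)} {suc zero} _ = via-row c zero (λ ()) (λ ())
  cols {suc (suc _)} {suc (suc _)} d =
    col-zigzag c {b = zero} {i = suc zero} {i' = zero} (λ ()) d (λ ()) (λ ()) (λ ()) (λ ()) (λ ())

-- The two cases of the theorem, under the hypotheses they actually need.
pcOpt≡4 : 4 ≤ m → 2 ≤ n → n ≤ 3 → PcOptIs m n 4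
pcOpt≡4 {suc m} {suc (suc n)} m≥4 _ (s≤s (s≤s n≤1)) =
  (forkColoring , forkColoring-connected n≤1 , forkColoring-cost {m = m} {n = n}) , (λ c → cost≥4 c m≥4)
pcOpt≡4 {suc m} {suc zero} _ (s≤s ()) _

pcOpt≡5 : 5 ≤ m → 4 ≤ n → PcOptIs m n 5
pcOpt≡5 {suc (suc m)} {suc (suc n)} m≥5 n≥4 =
  (doubleForkColoring , doubleForkColoring-connected , doubleForkColoring-cost {m = m} {n = n}) , (λ c → cost≥5 c m≥5 n≥4)
pcOpt≡5 {suc zero} (s≤s ()) _
pcOpt≡5 {n = suc zero} _ (s≤s ())

theorem7 : ∀ (m n : ℕ) → n ≤ m → 2 ≤ n → 9 ≤ m + n →
    (n ≤ 3 → PcOptIs m n 4) × (4 ≤ n → PcOptIs m n 5)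
theorem7 m n n≤m n≥2 m+n≥9 = (λ n≤3 → pcOpt≡4 (m≥4 n≤3) n≥2 n≤3) , (λ n≥4 → pcOpt≡5 m≥5 n≥4)
  where
  -- n ≤ 3 leaves m ≥ 6.
  m≥4 : n ≤ 3 → 4 ≤ m
  m≥4 n≤3 = ≤-trans (s≤s (s≤s (s≤s (s≤s z≤n)))) (+-cancelʳ-≤ 3 6 m (≤-trans m+n≥9 (+-monoʳ-≤ m n≤3)))
  m≥5 : 5 ≤ m
  m≥5 with 5 ≤? m
  ... | yes m≥5 = m≥5
  ... | no m≱5 = contradiction (≤-trans m+n≥9 (+-mono-≤ m≤4 (≤-trans n≤m m≤4))) (<-irrefl refl)
    where
    m≤4 : m ≤ 4
    m≤4 = ≤-pred (≰⇒> m≱5)
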